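{- Let $T_n=ct\left[(x^{ -1}+1+x)^n\right]$ be the central trinomial coefficients and let $p$ be a prime. Then $(T_n\bmod p)_{n\ge0}$ is uniformly recurrent if and only if $p$ divides no $T_n$ ($n\ge 0$), and $p$ divides some $T_n$ if and only if it divides some $T_n$ with $n<p$. Furthermore, if $p$ divides some $T_n$, then the set $\{n\ge0: T_n\equiv 0\pmod p\}$ has density $1$.
   Context: $ct[R(x)]$ denotes the constant term of a Laurent polynomial $R(x)$. A sequence $(s_n)$ is uniformly recurrent if for every finite word $w=s_i\cdots s_{i+\ell-1}$ occurring in it there is a constant $C_w$ such that every occurrence of $w$ is followed by another occurrence of $w$ starting at distance at most $C_w$. A set $S\subseteq\mathbb{Z}_{\ge0}$ has density $1$ if $|S\cap\{0,\ldots,N-1\}|/N\to1$. -}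

module Defs where

open import Data.Nat using (ℕ; zero; suc; _+_; _*_; _∸_; _≤_; _<_; NonZero)
open import Data.Nat.DivMod using (_%_)
open import Data.Integer as ℤ using (ℤ; +_)
open import Data.Bool using (Bool; true; false; if_then_else_)
open import Relation.Nullary.Decidable using (⌊_⌋)
open import Data.Product using (Σ; ∃; _×_)
open import Relation.Binary.PropositionalEquality using (_≡_)

-- coeff n j = coefficient of x^j in the Laurent polynomial (x⁻¹ + 1 + x)^n.
-- Multiplying by (x⁻¹ + 1 + x) sends coefficient c_j to c_{j+1} + c_j + c_{j-1}.
coeff : ℕ → ℤ → ℕ
coeff zero    j = if ⌊ j ℤ.≟ + 0 ⌋ then 1 else 0
coeff (suc n) j = coeff n (j ℤ.+ + 1) + coeff n j + coeff n (j ℤ.- + 1)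

T : ℕ → ℕ
T n = coeff n (+ 0)

SameWord : {A : Set} → (ℕ → A) → ℕ → ℕ → ℕ → Set
SameWord s ℓ i j = ∀ t → t < ℓ → s (j + t) ≡ s (i + t)

UniformlyRecurrent : {A : Set} → (ℕ → A) → Set
UniformlyRecurrent s =
  ∀ (i ℓ : ℕ) → ∃ λ (C : ℕ) → ∀ (j : ℕ) → SameWord s ℓ i j →
    Σ ℕ λ j′ → (j < j′) × (j′ ≤ j + C) × SameWord s ℓ i j′

count : (ℕ → Bool) → ℕ → ℕ
count P zero    = 0
count P (suc N) = count P N + (if P N then 1 else 0)

-- Density 1: |S ∩ {0..N-1}| / N → 1, i.e. for every k ≥ 1 there is N₀ such that
-- for all N ≥ N₀ the proportion of missing elements is ≤ 1/k.
HasDensityOne : (ℕ → Bool) → Set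
HasDensityOne P = ∀ (k : ℕ) → 1 ≤ k → ∃ λ (N₀ : ℕ) → ∀ (N : ℕ) → N₀ ≤ N →
  k * (N ∸ count P N) ≤ N

isZeroMod : (p : ℕ) → .{{_ : NonZero p}} → ℕ → Bool
isZeroMod p n = ⌊ T n % p Data.Nat.≟ 0 ⌋

{-# OPTIONS --safe #-}
module Submission where

-- Modulo a prime p the binomial theorem
-- gives (x⁻¹ + 1 + x)ᵖ ≡ x⁻ᵖ + 1 + xᵖ, so in (x⁻¹ + 1 + x)ᵏ⁺ⁿᵖ with k < p the first
-- factor only meets the constant term of the second: T (k + n p) ≡ T n · T k, and T is
-- multiplicative over base-p digits. Hence p divides some T n iff it divides T d for a
-- digit d < p. With such a zero digit, at most (p - 1)ᴷ of the first pᴷ indices avoid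
-- it, giving density one; and an index j with T j ≡ 1 whose last digits all equal the
-- largest digit g with p ∤ T g is followed by a long run of zeros, which rules out
-- uniform recurrence. Without a zero digit every T n is a unit mod p, so by
-- pigeonhole T n has an inverse of the form T m with m < p^(p-1); thus the m with
-- T m ≡ 1 have bounded gaps, and every word at position i recurs at i + m pᴹ.

open import Defs
import Algebra.Properties.CommutativeSemigroup as CommutativeSemigroupProperties
open import Data.Integer as ℤ using (ℤ; +_; +0; +[1+_]; -[1+_]; ∣_∣)
import Data.Integer.Properties as ℤP
import Data.Integer.Tactic.RingSolver as ℤ-Solver
open import Data.List using (applyUpTo; _∷ʳ_; [_])
open import Data.List.Properties using (applyUpTo-∷ʳ)
open import Data.Nat
open import Data.Nat.Combinatorics using (_C_; nCn≡1; nC1≡n; k>n⇒nCk≡0; nCk+nC[k+1]≡[n+1]C[k+1])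
open import Data.Nat.DivMod
open import Data.Nat.Divisibility
open import Data.Nat.GeneralisedArithmetic using (fold; fold-+)
open import Data.Nat.Induction using (<-rec)
open import Data.Nat.ListAction using (sum)
open import Data.Nat.ListAction.Properties using (sum-++)
open import Data.Nat.Primality using (Prime; euclidsLemma; prime⇒nonTrivial)
open import Data.Nat.Properties
import Data.Nat.Tactic.RingSolver as ℕ-Solver
open import Data.Bool using (Bool; true; false; not; if_then_else_)
open import Data.Fin as Fin using (Fin; toℕ; punchOut)
open import Data.Fin.Properties using (pigeonhole; toℕ-fromℕ<; toℕ≤pred[n]; punchOut-injective)
open import Data.Product using (Σ; ∃; ∃₂; _×_; _,_)
open import Data.Sum using (_⊎_; inj₁; inj₂; [_,_]′)
open import Function using (_∘_)
open import Function.Bundles using (_⇔_; mk⇔)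
open import Relation.Binary.Bundles using (Setoid)
open import Relation.Binary.Structures using (IsEquivalence)
import Relation.Binary.Reasoning.Setoid as SetoidReasoning
open import Relation.Binary.PropositionalEquality
  using (_≡_; _≢_; refl; sym; trans; cong; cong₂; cong-app; subst; _≗_; module ≡-Reasoning)
open import Relation.Nullary using (¬_; yes; no; contradiction)
open import Relation.Unary using (Decidable)

module ℕ+ = CommutativeSemigroupProperties +-commutativeSemigroup
module ℤ+ = CommutativeSemigroupProperties ℤP.+-commutativeSemigroup

-- Coefficient sequences and multiplication by x⁻ᵃ + 1 + xᵃ

Laurent : Set
Laurent = ℤ → ℕ

δ : Laurent
δ = coeff 0

Δ[_] : ℕ → Laurent → Laurent
Δ[ a ] f j = f (j ℤ.+ + a) + f j + f (j ℤ.- + a)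

Δ[_]^[_] : ℕ → ℕ → Laurent → Laurent
Δ[ a ]^[ n ] f = fold f Δ[ a ] n

∇ : Laurent → Laurent
∇ f j = f j + f (j ℤ.- + 1)

∇^[_] : ℕ → Laurent → Laurent
∇^[ m ] f = fold f ∇ m

Δ-cong : ∀ a {f g} → f ≗ g → Δ[ a ] f ≗ Δ[ a ] g
Δ-cong a f≗g j = cong₂ _+_ (cong₂ _+_ (f≗g _) (f≗g j)) (f≗g _)

coeff≗Δ^δ : ∀ n → coeff n ≗ Δ[ 1 ]^[ n ] δ
coeff≗Δ^δ zero    j = refl
coeff≗Δ^δ (suc n) = Δ-cong 1 (coeff≗Δ^δ n)

Δ^-*ˡ : ∀ a k c f j → Δ[ a ]^[ k ] (λ t → c * f t) j ≡ c * Δ[ a ]^[ k ] f j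
Δ^-*ˡ a zero    c f j = refl
Δ^-*ˡ a (suc k) c f j = begin
    Δ[ a ]^[ k ] cf (j ℤ.+ + a) + Δ[ a ]^[ k ] cf j + Δ[ a ]^[ k ] cf (j ℤ.- + a)
  ≡⟨ cong₂ _+_ (cong₂ _+_ (Δ^-*ˡ a k c f _) (Δ^-*ˡ a k c f j)) (Δ^-*ˡ a k c f _) ⟩
    c * F (j ℤ.+ + a) + c * F j + c * F (j ℤ.- + a)
  ≡⟨ *-distribˡ-+₃ c (F (j ℤ.+ + a)) (F j) (F (j ℤ.- + a)) ⟨
    c * Δ[ a ] F j ∎
  where
  open ≡-Reasoning
  cf = λ t → c * f t
  F = Δ[ a ]^[ k ] f
  *-distribˡ-+₃ : ∀ c x y z → c * (x + y + z) ≡ c * x + c * y + c * z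
  *-distribˡ-+₃ = ℕ-Solver.solve-∀

Δ^-local : ∀ k {f g} j → (∀ u → ∣ u ∣ ≤ k → f (j ℤ.+ u) ≡ g (j ℤ.+ u)) →
           Δ[ 1 ]^[ k ] f j ≡ Δ[ 1 ]^[ k ] g j
Δ^-local zero {f} {g} j agree = subst (λ x → f x ≡ g x) (ℤP.+-identityʳ j) (agree (+ 0) z≤n)
Δ^-local (suc k) {f} {g} j agree =
  cong₂ _+_ (cong₂ _+_ (Δ^-local k (j ℤ.+ + 1) (agree-shifted (+ 1) ≤-refl))
                       (Δ^-local k j (λ u ∣u∣≤k → agree u (m≤n⇒m≤1+n ∣u∣≤k))))
            (Δ^-local k (j ℤ.- + 1) (agree-shifted (ℤ.- + 1) ≤-refl))
  where
  agree-shifted : ∀ s → ∣ s ∣ ≤ 1 → ∀ u → ∣ u ∣ ≤ k → f (j ℤ.+ s ℤ.+ u) ≡ g (j ℤ.+ s ℤ.+ u)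
  agree-shifted s ∣s∣≤1 u ∣u∣≤k rewrite ℤP.+-assoc j s u =
    agree (s ℤ.+ u) (≤-trans (ℤP.∣i+j∣≤∣i∣+∣j∣ s u) (+-mono-≤ ∣s∣≤1 ∣u∣≤k))

Δ^δ-atMultiple : ∀ a n i → Δ[ suc a ]^[ n ] δ (i ℤ.* + suc a) ≡ coeff n i
Δ^δ-atMultiple a zero    +0       = refl
Δ^δ-atMultiple a zero    +[1+ m ] = refl
Δ^δ-atMultiple a zero    -[1+ m ] = refl
Δ^δ-atMultiple a (suc n) i =
  cong₂ _+_ (cong₂ _+_ (trans (cong F (i*x+x≡[i+1]*x i (+ suc a))) (Δ^δ-atMultiple a n (i ℤ.+ + 1)))
                       (Δ^δ-atMultiple a n i))
            (trans (cong F (i*x-x≡[i-1]*x i (+ suc a))) (Δ^δ-atMultiple a n (i ℤ.- + 1)))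
  where
  F = Δ[ suc a ]^[ n ] δ
  i*x+x≡[i+1]*x : ∀ i x → i ℤ.* x ℤ.+ x ≡ (i ℤ.+ + 1) ℤ.* x
  i*x+x≡[i+1]*x = ℤ-Solver.solve-∀
  i*x-x≡[i-1]*x : ∀ i x → i ℤ.* x ℤ.- x ≡ (i ℤ.- + 1) ℤ.* x
  i*x-x≡[i-1]*x = ℤ-Solver.solve-∀

multiple+offset≢0 : ∀ a i r → 0 < r → r ≤ a → i ℤ.* + suc a ℤ.+ + r ≢ + 0
multiple+offset≢0 a i r@(suc _) _ r≤a eq = <⇒≱ (s≤s r≤a) (∣⇒≤ (divides ∣ i ∣ r≡∣i∣*[1+a]))
  where
  open ≡-Reasoning
  cancel : ∀ x y → y ≡ ℤ.- x ℤ.+ (x ℤ.+ y)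
  cancel = ℤ-Solver.solve-∀
  r≡∣i∣*[1+a] : r ≡ ∣ i ∣ * suc a
  r≡∣i∣*[1+a] = begin
      r
    ≡⟨ cong ∣_∣ (cancel (i ℤ.* + suc a) (+ r)) ⟩
      ∣ ℤ.- (i ℤ.* + suc a) ℤ.+ (i ℤ.* + suc a ℤ.+ + r) ∣
    ≡⟨ cong (λ x → ∣ ℤ.- (i ℤ.* + suc a) ℤ.+ x ∣) eq ⟩
      ∣ ℤ.- (i ℤ.* + suc a) ℤ.+ + 0 ∣
    ≡⟨ cong ∣_∣ (ℤP.+-identityʳ (ℤ.- (i ℤ.* + suc a))) ⟩
      ∣ ℤ.- (i ℤ.* + suc a) ∣
    ≡⟨ ℤP.∣-i∣≡∣i∣ (i ℤ.* + suc a) ⟩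
      ∣ i ℤ.* + suc a ∣
    ≡⟨ ℤP.abs-* i (+ suc a) ⟩
      ∣ i ∣ * suc a ∎

Δ^δ-offMultiple : ∀ a n i r → 0 < r → r ≤ a → Δ[ suc a ]^[ n ] δ (i ℤ.* + suc a ℤ.+ + r) ≡ 0
Δ^δ-offMultiple a zero    i r 0<r r≤a with i ℤ.* + suc a ℤ.+ + r ℤ.≟ + 0
... | yes eq = contradiction eq (multiple+offset≢0 a i r 0<r r≤a)
... | no _   = refl
Δ^δ-offMultiple a (suc n) i r 0<r r≤a =
  cong₂ _+_ (cong₂ _+_ (trans (cong F (i*x+r+x≡[i+1]*x+r i (+ suc a) (+ r)))
                              (Δ^δ-offMultiple a n (i ℤ.+ + 1) r 0<r r≤a))
                       (Δ^δ-offMultiple a n i r 0<r r≤a))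
            (trans (cong F (i*x+r-x≡[i-1]*x+r i (+ suc a) (+ r)))
                   (Δ^δ-offMultiple a n (i ℤ.- + 1) r 0<r r≤a))
  where
  F = Δ[ suc a ]^[ n ] δ
  i*x+r+x≡[i+1]*x+r : ∀ i x r → i ℤ.* x ℤ.+ r ℤ.+ x ≡ (i ℤ.+ + 1) ℤ.* x ℤ.+ r
  i*x+r+x≡[i+1]*x+r = ℤ-Solver.solve-∀
  i*x+r-x≡[i-1]*x+r : ∀ i x r → i ℤ.* x ℤ.+ r ℤ.- x ≡ (i ℤ.- + 1) ℤ.* x ℤ.+ r
  i*x+r-x≡[i-1]*x+r = ℤ-Solver.solve-∀

Δ^δ-nearZero : ∀ a n u → ∣ u ∣ ≤ a → Δ[ suc a ]^[ n ] δ u ≡ coeff n (+ 0) * δ u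
Δ^δ-nearZero a n +0 _ = trans (Δ^δ-atMultiple a n (+ 0)) (sym (*-identityʳ _))
Δ^δ-nearZero a n +[1+ m ] m<a =
  trans (Δ^δ-offMultiple a n (+ 0) (suc m) z<s m<a) (sym (*-zeroʳ (coeff n (+ 0))))
Δ^δ-nearZero a n -[1+ m ] m<a = begin
    Δ[ suc a ]^[ n ] δ -[1+ m ]
  ≡⟨ cong (Δ[ suc a ]^[ n ] δ) -[1+m]≡-[1+a]+[a-m] ⟩
    Δ[ suc a ]^[ n ] δ (-[1+ 0 ] ℤ.* + suc a ℤ.+ + (a ∸ m))
  ≡⟨ Δ^δ-offMultiple a n -[1+ 0 ] (a ∸ m) (m<n⇒0<n∸m m<a) (m∸n≤m a m) ⟩
    0
  ≡⟨ *-zeroʳ (coeff n (+ 0)) ⟨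
    coeff n (+ 0) * 0 ∎
  where
  open ≡-Reasoning
  -1-a+[a-m]≡-1-m : ∀ a m → ℤ.- (+ 1) ℤ.* (+ 1 ℤ.+ a) ℤ.+ (a ℤ.- m) ≡ ℤ.- (+ 1 ℤ.+ m)
  -1-a+[a-m]≡-1-m = ℤ-Solver.solve-∀
  -[1+m]≡-[1+a]+[a-m] : -[1+ m ] ≡ -[1+ 0 ] ℤ.* + suc a ℤ.+ + (a ∸ m)
  -[1+m]≡-[1+a]+[a-m] = begin
      -[1+ m ]
    ≡⟨ -1-a+[a-m]≡-1-m (+ a) (+ m) ⟨
      -[1+ 0 ] ℤ.* + suc a ℤ.+ (+ a ℤ.- + m)
    ≡⟨ cong (λ x → -[1+ 0 ] ℤ.* + suc a ℤ.+ x) (trans (ℤP.m-n≡m⊖n a m) (ℤP.⊖-≥ (<⇒≤ m<a))) ⟩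
      -[1+ 0 ] ℤ.* + suc a ℤ.+ + (a ∸ m) ∎

-- The binomial theorem

-- The sum of g i m over the 2ⁿ lattice paths of n unit steps, each to the right or up,
-- (i, m) being the endpoint: (X + Y)ⁿ expanded before collecting terms.
pathSum : ℕ → (ℕ → ℕ → ℕ) → ℕ
pathSum zero    g = g 0 0
pathSum (suc n) g = pathSum n (λ i m → g (suc i) m) + pathSum n (λ i m → g i (suc m))

pathSum-cong : ∀ n {g h} → (∀ i m → g i m ≡ h i m) → pathSum n g ≡ pathSum n h
pathSum-cong zero    g≡h = g≡h 0 0
pathSum-cong (suc n) g≡h =
  cong₂ _+_ (pathSum-cong n (λ i m → g≡h (suc i) m)) (pathSum-cong n (λ i m → g≡h i (suc m)))

pathSum-+ : ∀ n g h → pathSum n (λ i m → g i m + h i m) ≡ pathSum n g + pathSum n h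
pathSum-+ zero    g h = refl
pathSum-+ (suc n) g h = trans
  (cong₂ _+_ (pathSum-+ n (λ i m → g (suc i) m) (λ i m → h (suc i) m))
             (pathSum-+ n (λ i m → g i (suc m)) (λ i m → h i (suc m))))
  (ℕ+.interchange (pathSum n (λ i m → g (suc i) m)) _ _ _)

∇^-pathSum : ∀ m f x → ∇^[ m ] f x ≡ pathSum m (λ i _ → f (x ℤ.- + i))
∇^-pathSum zero    f x = cong f (sym (ℤP.+-identityʳ x))
∇^-pathSum (suc m) f x = begin
    ∇^[ m ] f x + ∇^[ m ] f (x ℤ.- + 1)
  ≡⟨ cong₂ _+_ (∇^-pathSum m f x) (∇^-pathSum m f (x ℤ.- + 1)) ⟩
    pathSum m (λ i _ → f (x ℤ.- + i)) + pathSum m (λ i _ → f (x ℤ.- + 1 ℤ.- + i))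
  ≡⟨ +-comm (pathSum m (λ i _ → f (x ℤ.- + i))) _ ⟩
    pathSum m (λ i _ → f (x ℤ.- + 1 ℤ.- + i)) + pathSum m (λ i _ → f (x ℤ.- + i))
  ≡⟨ cong (λ s → s + pathSum m (λ i _ → f (x ℤ.- + i)))
          (pathSum-cong m (λ i _ → cong f (x-1-i≡x-[1+i] x (+ i)))) ⟩
    pathSum (suc m) (λ i _ → f (x ℤ.- + i)) ∎
  where
  open ≡-Reasoning
  x-1-i≡x-[1+i] : ∀ x i → x ℤ.- + 1 ℤ.- i ≡ x ℤ.- (+ 1 ℤ.+ i)
  x-1-i≡x-[1+i] = ℤ-Solver.solve-∀

Δ^-pathSum : ∀ n f j → Δ[ 1 ]^[ n ] f j ≡ pathSum n (λ i m → ∇^[ m ] f (j ℤ.+ + i))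
Δ^-pathSum zero    f j = cong f (sym (ℤP.+-identityʳ j))
Δ^-pathSum (suc n) f j = begin
    P (j ℤ.+ + 1) + P j + P (j ℤ.- + 1)
  ≡⟨ cong₂ (λ x y → x + y + P (j ℤ.- + 1)) (Δ^-pathSum n f (j ℤ.+ + 1)) (Δ^-pathSum n f j) ⟩
    S (j ℤ.+ + 1) + S j + P (j ℤ.- + 1)
  ≡⟨ cong (λ x → S (j ℤ.+ + 1) + S j + x) (Δ^-pathSum n f (j ℤ.- + 1)) ⟩
    S (j ℤ.+ + 1) + S j + S (j ℤ.- + 1)
  ≡⟨ +-assoc (S (j ℤ.+ + 1)) _ _ ⟩
    S (j ℤ.+ + 1) + (S j + S (j ℤ.- + 1))
  ≡⟨ cong₂ _+_ (pathSum-cong n (λ i m → cong (∇^[ m ] f) (ℤP.+-assoc j (+ 1) (+ i))))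
               (sym (pathSum-+ n _ _)) ⟩
    pathSum n (λ i m → ∇^[ m ] f (j ℤ.+ + suc i))
      + pathSum n (λ i m → ∇^[ m ] f (j ℤ.+ + i) + ∇^[ m ] f (j ℤ.- + 1 ℤ.+ + i))
  ≡⟨ cong₂ _+_ refl (pathSum-cong n (λ i m →
       cong (λ x → ∇^[ m ] f (j ℤ.+ + i) + ∇^[ m ] f x) (ℤ+.xy∙z≈xz∙y j (ℤ.- + 1) (+ i)))) ⟩
    pathSum (suc n) (λ i m → ∇^[ m ] f (j ℤ.+ + i)) ∎
  where
  open ≡-Reasoning
  P = Δ[ 1 ]^[ n ] f
  S = λ x → pathSum n (λ i m → ∇^[ m ] f (x ℤ.+ + i))

∑ : ℕ → (ℕ → ℕ) → ℕ
∑ n G = sum (applyUpTo G n)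

∑-cong : ∀ n {G H} → (∀ i → i < n → G i ≡ H i) → ∑ n G ≡ ∑ n H
∑-cong zero    G≡H = refl
∑-cong (suc n) G≡H = cong₂ _+_ (G≡H 0 z<s) (∑-cong n (λ i i<n → G≡H (suc i) (s<s i<n)))

∑-+ : ∀ n G H → ∑ n (λ i → G i + H i) ≡ ∑ n G + ∑ n H
∑-+ zero    G H = refl
∑-+ (suc n) G H =
  trans (cong₂ _+_ refl (∑-+ n (G ∘ suc) (H ∘ suc))) (ℕ+.interchange (G 0) (H 0) _ _)

∑-last : ∀ n G → ∑ (suc n) G ≡ ∑ n G + G n
∑-last n G = begin
  sum (applyUpTo G (suc n))         ≡⟨ cong sum (applyUpTo-∷ʳ G n) ⟨
  sum (applyUpTo G n ∷ʳ G n)        ≡⟨ sum-++ (applyUpTo G n) [ G n ] ⟩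
  ∑ n G + (G n + 0)                 ≡⟨ cong₂ _+_ refl (+-identityʳ (G n)) ⟩
  ∑ n G + G n                       ∎
  where open ≡-Reasoning

∣-∑ : ∀ {d} n G → (∀ i → i < n → d ∣ G i) → d ∣ ∑ n G
∣-∑ zero    G d∣G = _ ∣0
∣-∑ (suc n) G d∣G = ∣m∣n⇒∣m+n (d∣G 0 z<s) (∣-∑ n (G ∘ suc) (λ i i<n → d∣G (suc i) (s<s i<n)))

[k+1]*[n+1]C[k+1]≡[n+1]*nCk : ∀ n k → suc k * (suc n C suc k) ≡ suc n * (n C k)
[k+1]*[n+1]C[k+1]≡[n+1]*nCk zero    zero    = refl
[k+1]*[n+1]C[k+1]≡[n+1]*nCk zero    (suc k) = *-zeroʳ (suc (suc k))
[k+1]*[n+1]C[k+1]≡[n+1]*nCk (suc n) zero    =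
  trans (+-identityʳ _) (trans (nC1≡n (suc (suc n))) (sym (*-identityʳ (suc (suc n)))))
[k+1]*[n+1]C[k+1]≡[n+1]*nCk (suc n) (suc k) = begin
    (2 + k) * ((2 + n) C (2 + k))
  ≡⟨ cong ((2 + k) *_) (nCk+nC[k+1]≡[n+1]C[k+1] (suc n) (suc k)) ⟨
    (2 + k) * ((1 + n) C (1 + k) + (1 + n) C (2 + k))
  ≡⟨ regroup k ((1 + n) C (1 + k)) ((1 + n) C (2 + k)) ⟩
    (1 + k) * ((1 + n) C (1 + k)) + ((1 + n) C (1 + k)) + (2 + k) * ((1 + n) C (2 + k))
  ≡⟨ cong₂ (λ x y → x + ((1 + n) C (1 + k)) + y)
           ([k+1]*[n+1]C[k+1]≡[n+1]*nCk n k) ([k+1]*[n+1]C[k+1]≡[n+1]*nCk n (suc k)) ⟩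
    (1 + n) * (n C k) + ((1 + n) C (1 + k)) + (1 + n) * (n C (1 + k))
  ≡⟨ cong (λ x → (1 + n) * (n C k) + x + (1 + n) * (n C (1 + k)))
          (nCk+nC[k+1]≡[n+1]C[k+1] n k) ⟨
    (1 + n) * (n C k) + (n C k + n C (1 + k)) + (1 + n) * (n C (1 + k))
  ≡⟨ regroup′ n (n C k) (n C (1 + k)) ⟩
    (2 + n) * (n C k + n C (1 + k))
  ≡⟨ cong ((2 + n) *_) (nCk+nC[k+1]≡[n+1]C[k+1] n k) ⟩
    (2 + n) * ((1 + n) C (1 + k)) ∎
  where
  open ≡-Reasoning
  regroup : ∀ k x y → (2 + k) * (x + y) ≡ (1 + k) * x + x + (2 + k) * y
  regroup = ℕ-Solver.solve-∀
  regroup′ : ∀ n x y → (1 + n) * x + (x + y) + (1 + n) * y ≡ (2 + n) * (x + y)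
  regroup′ = ℕ-Solver.solve-∀

pathSum≡binomialSum : ∀ n g → pathSum n g ≡ ∑ (suc n) (λ i → (n C i) * g i (n ∸ i))
pathSum≡binomialSum zero    g = sym (trans (+-identityʳ (1 * g 0 0)) (*-identityˡ (g 0 0)))
pathSum≡binomialSum (suc n) g = begin
    pathSum n (λ i m → g (suc i) m) + pathSum n (λ i m → g i (suc m))
  ≡⟨ cong₂ _+_ (pathSum≡binomialSum n _) (pathSum≡binomialSum n _) ⟩
    A + (X + B′)
  ≡⟨ ℕ+.x∙yz≈y∙xz A X B′ ⟩
    X + (A + B′)
  ≡⟨ cong (λ b → X + (A + b)) B′≡B ⟩
    X + (A + B)
  ≡⟨ cong (λ s → X + s)
          (∑-+ (suc n) (λ i → (n C i) * g (suc i) (n ∸ i)) (λ i → (n C suc i) * g (suc i) (n ∸ i))) ⟨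
    X + ∑ (suc n) (λ i → (n C i) * g (suc i) (n ∸ i) + (n C suc i) * g (suc i) (n ∸ i))
  ≡⟨ cong (λ s → X + s) (∑-cong (suc n) (λ i _ → pascal i)) ⟩
    X + ∑ (suc n) (λ i → (suc n C suc i) * g (suc i) (n ∸ i)) ∎
  where
  open ≡-Reasoning
  X  = 1 * g 0 (suc n)
  A  = ∑ (suc n) (λ i → (n C i) * g (suc i) (n ∸ i))
  B′ = ∑ n (λ i → (n C suc i) * g (suc i) (suc (n ∸ suc i)))
  B  = ∑ (suc n) (λ i → (n C suc i) * g (suc i) (n ∸ i))
  B′≡B : B′ ≡ B
  B′≡B = begin
      B′
    ≡⟨ ∑-cong n (λ i i<n → cong (λ m → (n C suc i) * g (suc i) m) (+-∸-assoc 1 i<n)) ⟨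
      ∑ n (λ i → (n C suc i) * g (suc i) (n ∸ i))
    ≡⟨ +-identityʳ _ ⟨
      ∑ n (λ i → (n C suc i) * g (suc i) (n ∸ i)) + 0
    ≡⟨ cong₂ _+_ refl (cong (_* g (suc n) (n ∸ n)) (k>n⇒nCk≡0 (n<1+n n))) ⟨
      ∑ n (λ i → (n C suc i) * g (suc i) (n ∸ i)) + (n C suc n) * g (suc n) (n ∸ n)
    ≡⟨ ∑-last n _ ⟨
      B ∎
  pascal : ∀ i → (n C i) * g (suc i) (n ∸ i) + (n C suc i) * g (suc i) (n ∸ i)
                 ≡ (suc n C suc i) * g (suc i) (n ∸ i)
  pascal i = trans (sym (*-distribʳ-+ (g (suc i) (n ∸ i)) (n C i) _))
                   (cong (_* g (suc i) (n ∸ i)) (nCk+nC[k+1]≡[n+1]C[k+1] n i))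

-- Counting, density and recurrence

n<m^n : ∀ m → 1 < m → ∀ n → n < m ^ n
n<m^n m 1<m zero    = z<s
n<m^n m 1<m (suc n) = ≤-<-trans (n<m^n m 1<m n) (^-monoʳ-< m 1<m (n<1+n n))
  where instance _ = >-nonZero (<-trans z<s 1<m)

m<[1+m/n]*n : ∀ m n .{{_ : NonZero n}} → m < suc (m / n) * n
m<[1+m/n]*n m n = begin-strict
  m                  ≡⟨ m≡m%n+[m/n]*n m n ⟩
  m % n + m / n * n  <⟨ +-monoˡ-< (m / n * n) (m%n<n m n) ⟩
  n + m / n * n      ∎
  where open ≤-Reasoning

indicator : Bool → ℕ
indicator b = if b then 1 else 0

indicator≤1 : ∀ b → indicator b ≤ 1
indicator≤1 true  = ≤-refl
indicator≤1 false = z≤n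

indicator-mono : ∀ {a b} → (a ≡ true → b ≡ true) → indicator a ≤ indicator b
indicator-mono {false} _   = z≤n
indicator-mono {true}  a⇒b rewrite a⇒b refl = ≤-refl

count-≤ : ∀ P N → count P N ≤ N
count-≤ P zero    = z≤n
count-≤ P (suc N) = subst (count P (suc N) ≤_) (+-comm N 1) (+-mono-≤ (count-≤ P N) (indicator≤1 (P N)))

count+count-not : ∀ P N → count P N + count (not ∘ P) N ≡ N
count+count-not P zero    = refl
count+count-not P (suc N) = begin
    count P N + indicator (P N) + (count (not ∘ P) N + indicator (not (P N)))
  ≡⟨ ℕ+.interchange (count P N) (indicator (P N)) (count (not ∘ P) N) _ ⟩
    count P N + count (not ∘ P) N + (indicator (P N) + indicator (not (P N)))
  ≡⟨ cong₂ _+_ (count+count-not P N) (indicator+indicator-not (P N)) ⟩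
    N + 1
  ≡⟨ +-comm N 1 ⟩
    suc N ∎
  where
  open ≡-Reasoning
  indicator+indicator-not : ∀ b → indicator b + indicator (not b) ≡ 1
  indicator+indicator-not true  = refl
  indicator+indicator-not false = refl

count-+ : ∀ P a b → count P (a + b) ≡ count P a + count (λ i → P (a + i)) b
count-+ P a zero    = trans (cong (count P) (+-identityʳ a)) (sym (+-identityʳ (count P a)))
count-+ P a (suc b) = begin
  count P (a + suc b)                                              ≡⟨ cong (count P) (+-suc a b) ⟩
  count P (a + b) + indicator (P (a + b))                          ≡⟨ cong (_+ indicator (P (a + b))) (count-+ P a b) ⟩
  count P a + count (λ i → P (a + i)) b + indicator (P (a + b))    ≡⟨ +-assoc (count P a) _ _ ⟩
  count P a + count (λ i → P (a + i)) (suc b)                      ∎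
  where open ≡-Reasoning

count-mono : ∀ {P Q} N → (∀ i → i < N → P i ≡ true → Q i ≡ true) → count P N ≤ count Q N
count-mono zero    _   = z≤n
count-mono (suc N) P⇒Q =
  +-mono-≤ (count-mono N (λ i i<N → P⇒Q i (m<n⇒m<1+n i<N))) (indicator-mono (P⇒Q N ≤-refl))

count-monoʳ : ∀ P {N M} → N ≤ M → count P N ≤ count P M
count-monoʳ P {N} {M} N≤M = begin
  count P N                                     ≤⟨ m≤m+n (count P N) _ ⟩
  count P N + count (λ i → P (N + i)) (M ∸ N)   ≡⟨ count-+ P N (M ∸ N) ⟨
  count P (N + (M ∸ N))                         ≡⟨ cong (count P) (m+[n∸m]≡n N≤M) ⟩
  count P M                                     ∎
  where open ≤-Reasoning

count≡0 : ∀ P N → (∀ i → i < N → P i ≢ true) → count P N ≡ 0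
count≡0 P zero    _      = refl
count≡0 P (suc N) ¬P with P N in PN
... | true  = contradiction PN (¬P N ≤-refl)
... | false = trans (+-identityʳ _) (count≡0 P N (λ i i<N → ¬P i (m<n⇒m<1+n i<N)))

count<N : ∀ P {d} N → P d ≡ false → d < N → count P N < N
count<N P {d} (suc N) Pd≡false d<1+N with m≤n⇒m<n∨m≡n (s≤s⁻¹ d<1+N)
... | inj₁ d<N = begin-strict
  count P N + indicator (P N)   ≤⟨ +-monoʳ-≤ (count P N) (indicator≤1 (P N)) ⟩
  count P N + 1                 <⟨ +-monoˡ-< 1 (count<N P N Pd≡false d<N) ⟩
  N + 1                         ≡⟨ +-comm N 1 ⟩
  suc N                         ∎
  where open ≤-Reasoning
... | inj₂ refl rewrite Pd≡false = s≤s (subst (_≤ N) (sym (+-identityʳ _)) (count-≤ P N))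

count-blocks : ∀ P B → (∀ m i → i < B → P (i + m * B) ≡ true → P m ≡ true × P i ≡ true) →
               ∀ m → count P (m * B) ≤ count P m * count P B
count-blocks P B split zero    = z≤n
count-blocks P B split (suc m) = begin
    count P (B + m * B)
  ≡⟨ cong (count P) (+-comm B (m * B)) ⟩
    count P (m * B + B)
  ≡⟨ count-+ P (m * B) B ⟩
    count P (m * B) + count block B
  ≤⟨ +-mono-≤ (count-blocks P B split m) (count-block (P m) refl) ⟩
    count P m * count P B + indicator (P m) * count P B
  ≡⟨ *-distribʳ-+ (count P B) (count P m) _ ⟨
    count P (suc m) * count P B ∎
  where
  open ≤-Reasoning
  block : ℕ → Bool
  block i = P (m * B + i)
  split′ : ∀ i → i < B → block i ≡ true → P m ≡ true × P i ≡ true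
  split′ i i<B rewrite +-comm (m * B) i = split m i i<B
  count-block : ∀ b → P m ≡ b → count block B ≤ indicator b * count P B
  count-block true  _       = subst (count block B ≤_) (sym (*-identityˡ (count P B)))
    (count-mono B (λ i i<B blockᵢ → let _ , Pᵢ = split′ i i<B blockᵢ in Pᵢ))
  count-block false Pm≡false = ≤-reflexive (count≡0 block B (λ i i<B blockᵢ →
    let Pm , _ = split′ i i<B blockᵢ in contradiction (trans (sym Pm) Pm≡false) λ ()))

-- Bernoulli's inequality (1 + 1/c)ᴷ ≥ 1 + K/c, cleared of denominators.
bernoulli : ∀ c K → c ^ K * (c + K) ≤ c * suc c ^ K
bernoulli c zero    = ≤-reflexive (trans (+-identityʳ (c + 0)) (trans (+-identityʳ c) (sym (*-identityʳ c))))
bernoulli c (suc K) = begin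
    c ^ suc K * (c + suc K)
  ≡⟨ reassoc c K (c ^ K) ⟩
    c ^ K * (c * (c + K + 1))
  ≤⟨ *-monoʳ-≤ (c ^ K) (subst (c * (c + K + 1) ≤_) (sym (expand c K)) (m≤m+n _ K)) ⟩
    c ^ K * ((c + K) * (c + 1))
  ≡⟨ reassoc′ c K (c ^ K) ⟩
    c ^ K * (c + K) * suc c
  ≤⟨ *-monoˡ-≤ (suc c) (bernoulli c K) ⟩
    c * suc c ^ K * suc c
  ≡⟨ reassoc″ c (suc c ^ K) ⟩
    c * suc c ^ suc K ∎
  where
  open ≤-Reasoning
  reassoc : ∀ c K x → c * x * (c + suc K) ≡ x * (c * (c + K + 1))
  reassoc = ℕ-Solver.solve-∀
  expand : ∀ c K → (c + K) * (c + 1) ≡ c * (c + K + 1) + K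
  expand = ℕ-Solver.solve-∀
  reassoc′ : ∀ c K x → x * ((c + K) * (c + 1)) ≡ x * (c + K) * suc c
  reassoc′ = ℕ-Solver.solve-∀
  reassoc″ : ∀ c y → c * y * suc c ≡ c * (suc c * y)
  reassoc″ = ℕ-Solver.solve-∀

2k*c^[2kc]≤[1+c]^[2kc] : ∀ c .{{_ : NonZero c}} k → 2 * k * c ^ (2 * k * c) ≤ suc c ^ (2 * k * c)
2k*c^[2kc]≤[1+c]^[2kc] c k = *-cancelˡ-≤ c (begin
    c * (2 * k * c ^ K)
  ≡⟨ reassoc c k (c ^ K) ⟩
    c ^ K * K
  ≤⟨ *-monoʳ-≤ (c ^ K) (m≤n+m K c) ⟩
    c ^ K * (c + K)
  ≤⟨ bernoulli c K ⟩
    c * suc c ^ K ∎)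
  where
  open ≤-Reasoning
  K = 2 * k * c
  reassoc : ∀ c k x → c * (2 * k * x) ≡ x * (2 * k * c)
  reassoc = ℕ-Solver.solve-∀

-- With K = 2kc, Bernoulli's inequality makes the proportion (c / (1 + c))ᴷ of the
-- complement at most 1 / 2k.
hasDensityOne-if-sparse-complement : ∀ P c .{{_ : NonZero c}} →
  (∀ K m → count (not ∘ P) (m * suc c ^ K) ≤ m * c ^ K) → HasDensityOne P
hasDensityOne-if-sparse-complement P c sparse k _ = B , bound
  where
  K = 2 * k * c
  B = suc c ^ K
  instance _ = m^n≢0 (suc c) K
  bound : ∀ N → B ≤ N → k * (N ∸ count P N) ≤ N
  bound N B≤N = begin
      k * (N ∸ count P N)
    ≡⟨ cong (λ x → k * (x ∸ count P N)) (count+count-not P N) ⟨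
      k * (count P N + count (not ∘ P) N ∸ count P N)
    ≡⟨ cong (k *_) (m+n∸m≡n (count P N) _) ⟩
      k * count (not ∘ P) N
    ≤⟨ *-monoʳ-≤ k (count-monoʳ (not ∘ P) (<⇒≤ (m<[1+m/n]*n N B))) ⟩
      k * count (not ∘ P) (suc Q * B)
    ≤⟨ *-monoʳ-≤ k (sparse K (suc Q)) ⟩
      k * (suc Q * c ^ K)
    ≤⟨ *-monoʳ-≤ k (*-monoˡ-≤ (c ^ K) (+-monoˡ-≤ Q (m≥n⇒m/n>0 B≤N))) ⟩
      k * ((Q + Q) * c ^ K)
    ≡⟨ reassoc k Q (c ^ K) ⟩
      Q * (2 * k * c ^ K)
    ≤⟨ *-monoʳ-≤ Q (2k*c^[2kc]≤[1+c]^[2kc] c k) ⟩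
      Q * B
    ≤⟨ m/n*n≤m N B ⟩
      N ∎
    where
    open ≤-Reasoning
    Q = N / B
    reassoc : ∀ k Q x → k * ((Q + Q) * x) ≡ Q * (2 * k * x)
    reassoc = ℕ-Solver.solve-∀

-- The copies at i + m · B M come after every position j, whether or not the word
-- occurs at j.
uniformlyRecurrent-if-syndetic-copies : ∀ {A : Set} (s : ℕ → A) (B : ℕ → ℕ) → (∀ M → M < B M) →
  (∀ M → ∃ λ D → ∀ Q → ∃ λ m → Q < m × m ≤ Q + D × (∀ i → i < B M → s (i + m * B M) ≡ s i)) →
  UniformlyRecurrent s
uniformlyRecurrent-if-syndetic-copies s B M<B syndetic i ℓ with syndetic (i + ℓ)
... | D , copies = i + D * B (i + ℓ) , λ j _ → next-occurrence j
  where
  M = i + ℓ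
  instance _ = >-nonZero (≤-<-trans z≤n (M<B M))
  next-occurrence : ∀ j → Σ ℕ λ j′ → (j < j′) × (j′ ≤ j + (i + D * B M)) × SameWord s ℓ i j′
  next-occurrence j with copies (j / B M)
  ... | m , Q<m , m≤Q+D , copy = i + m * B M , j<j′ , j′≤j+C , same
    where
    open ≤-Reasoning
    Q = j / B M
    j<j′ : j < i + m * B M
    j<j′ = <-≤-trans (m<[1+m/n]*n j (B M)) (≤-trans (*-monoˡ-≤ (B M) Q<m) (m≤n+m _ i))
    j′≤j+C : i + m * B M ≤ j + (i + D * B M)
    j′≤j+C = begin
      i + m * B M               ≤⟨ +-monoʳ-≤ i (*-monoˡ-≤ (B M) m≤Q+D) ⟩
      i + (Q + D) * B M         ≡⟨ reassoc i Q D (B M) ⟩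
      Q * B M + (i + D * B M)   ≤⟨ +-monoˡ-≤ (i + D * B M) (m/n*n≤m j (B M)) ⟩
      j + (i + D * B M)         ∎
      where
      reassoc : ∀ i Q D x → i + (Q + D) * x ≡ Q * x + (i + D * x)
      reassoc = ℕ-Solver.solve-∀
    same : SameWord s ℓ i (i + m * B M)
    same t t<ℓ = trans (cong s (ℕ+.xy∙z≈xz∙y i (m * B M) t))
                       (copy (i + t) (<-trans (+-monoʳ-< i t<ℓ) (M<B M)))

¬uniformlyRecurrent-if-long-gaps : ∀ {A : Set} (s : ℕ → A) →
  (∀ w → ∃ λ j → s j ≡ s 0 × (∀ j′ → j < j′ → j′ ≤ j + w → s j′ ≢ s 0)) → ¬ UniformlyRecurrent s
¬uniformlyRecurrent-if-long-gaps s gaps recurrent =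
  let w , returns = recurrent 0 1
      j , sj≡s0 , gap = gaps w
      j′ , j<j′ , j′≤j+w , same = returns j λ { zero _ → trans (cong s (+-identityʳ j)) sj≡s0
                                              ; (suc _) (s≤s ()) }
  in gap j′ j<j′ j′≤j+w (trans (cong s (sym (+-identityʳ j′))) (same 0 z<s))

zero-after-nonzero : ∀ {Z : ℕ → Set} → Decidable Z → ¬ Z 0 → ∀ {d} → Z d →
                     ∃ λ a → suc a ≤ d × ¬ Z a × Z (suc a)
zero-after-nonzero Z? ¬Z0 {zero}  Z0 = contradiction Z0 ¬Z0
zero-after-nonzero Z? ¬Z0 {suc d} Zd+1 with Z? d
... | no ¬Zd = d , ≤-refl , ¬Zd , Zd+1
... | yes Zd = let a , a+1≤d , rest = zero-after-nonzero Z? ¬Z0 Zd in a , m≤n⇒m≤1+n a+1≤d , rest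

last-nonzero : ∀ {Z : ℕ → Set} → Decidable Z → ¬ Z 0 → ∀ b →
               ∃ λ g → g ≤ b × ¬ Z g × (∀ e → g < e → e ≤ b → Z e)
last-nonzero Z? ¬Z0 zero = 0 , z≤n , ¬Z0 , λ e 0<e e≤0 → contradiction e≤0 (<⇒≱ 0<e)
last-nonzero Z? ¬Z0 (suc b) with Z? (suc b)
... | no ¬Zb+1 = suc b , ≤-refl , ¬Zb+1 , λ e b+1<e e≤b+1 → contradiction e≤b+1 (<⇒≱ b+1<e)
... | yes Zb+1 = let g , g≤b , ¬Zg , above = last-nonzero Z? ¬Z0 b in
  g , m≤n⇒m≤1+n g≤b , ¬Zg , λ e g<e e≤b+1 →
    [ (λ e<b+1 → above e g<e (s≤s⁻¹ e<b+1)) , (λ { refl → Zb+1 }) ]′ (m≤n⇒m<n∨m≡n e≤b+1)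

-- Congruences modulo p

module Congruence (p : ℕ) .{{_ : NonZero p}} where

  infix 4 _≈_ _≋_

  -- Congruence modulo p, as a record so that Agda can infer both sides.
  record _≈_ (a b : ℕ) : Set where
    constructor mk≈
    field ≈⇒%≡ : a % p ≡ b % p
  open _≈_ public

  ≈-isEquivalence : IsEquivalence _≈_
  ≈-isEquivalence = record
    { refl  = mk≈ refl
    ; sym   = λ (mk≈ e) → mk≈ (sym e)
    ; trans = λ (mk≈ e) (mk≈ e′) → mk≈ (trans e e′)
    }

  open IsEquivalence ≈-isEquivalence public
    using () renaming (refl to ≈-refl; sym to ≈-sym; trans to ≈-trans; reflexive to ≈-reflexive)

  ≈-setoid : Setoid _ _
  ≈-setoid = record { isEquivalence = ≈-isEquivalence }

  module ≈-Reasoning = SetoidReasoning ≈-setoid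

  +-cong : ∀ {a a′ b b′} → a ≈ a′ → b ≈ b′ → a + b ≈ a′ + b′
  +-cong {a} {a′} {b} {b′} (mk≈ e₁) (mk≈ e₂) = mk≈ (begin
    (a + b) % p             ≡⟨ %-distribˡ-+ a b p ⟩
    (a % p + b % p) % p     ≡⟨ cong₂ (λ x y → (x + y) % p) e₁ e₂ ⟩
    (a′ % p + b′ % p) % p   ≡⟨ %-distribˡ-+ a′ b′ p ⟨
    (a′ + b′) % p           ∎)
    where open ≡-Reasoning

  *-cong : ∀ {a a′ b b′} → a ≈ a′ → b ≈ b′ → a * b ≈ a′ * b′
  *-cong {a} {a′} {b} {b′} (mk≈ e₁) (mk≈ e₂) = mk≈ (begin
    (a * b) % p             ≡⟨ %-distribˡ-* a b p ⟩
    (a % p * (b % p)) % p   ≡⟨ cong₂ (λ x y → (x * y) % p) e₁ e₂ ⟩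
    (a′ % p * (b′ % p)) % p ≡⟨ %-distribˡ-* a′ b′ p ⟨
    (a′ * b′) % p           ∎)
    where open ≡-Reasoning

  +-congˡ : ∀ a {b b′} → b ≈ b′ → a + b ≈ a + b′
  +-congˡ a = +-cong (≈-refl {a})

  *-congˡ : ∀ a {b b′} → b ≈ b′ → a * b ≈ a * b′
  *-congˡ a = *-cong (≈-refl {a})

  *-congʳ : ∀ b {a a′} → a ≈ a′ → a * b ≈ a′ * b
  *-congʳ b a≈a′ = *-cong a≈a′ (≈-refl {b})

  multiple+≈ : ∀ {m} n → p ∣ m → m + n ≈ n
  multiple+≈ n p∣m = mk≈ (%-remove-+ˡ n p∣m)

  ∣-resp-≈ : ∀ {a b} → a ≈ b → p ∣ b → p ∣ a
  ∣-resp-≈ {a} {b} (mk≈ e) p∣b = m%n≡0⇒n∣m a p (trans e (n∣m⇒m%n≡0 b p p∣b))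

  ≈⇒∣∸ : ∀ {x y} → x ≈ y → p ∣ y ∸ x
  ≈⇒∣∸ {x} {y} (mk≈ e) = divides (y / p ∸ x / p) (begin
    y ∸ x                                       ≡⟨ cong₂ _∸_ (m≡m%n+[m/n]*n y p) (m≡m%n+[m/n]*n x p) ⟩
    (y % p + y / p * p) ∸ (x % p + x / p * p)   ≡⟨ cong (λ r → (y % p + y / p * p) ∸ (r + x / p * p)) e ⟩
    (y % p + y / p * p) ∸ (y % p + x / p * p)   ≡⟨ [m+n]∸[m+o]≡n∸o (y % p) _ _ ⟩
    y / p * p ∸ x / p * p                       ≡⟨ *-distribʳ-∸ p (y / p) (x / p) ⟨
    (y / p ∸ x / p) * p                         ∎)
    where open ≡-Reasoning

  ∣∸⇒≈ : ∀ {x y} → x ≤ y → p ∣ y ∸ x → x ≈ y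
  ∣∸⇒≈ {x} {y} x≤y p∣y∸x =
    mk≈ (sym (trans (cong (_% p) (sym (m+[n∸m]≡n x≤y))) (%-remove-+ʳ x p∣y∸x)))

  _≋_ : Laurent → Laurent → Set
  f ≋ g = ∀ j → f j ≈ g j

  Δ-resp-≋ : ∀ a {f g} → f ≋ g → Δ[ a ] f ≋ Δ[ a ] g
  Δ-resp-≋ a f≋g j = +-cong (+-cong (f≋g _) (f≋g j)) (f≋g _)

  Δ^-resp-≋ : ∀ a n {f g} → f ≋ g → Δ[ a ]^[ n ] f ≋ Δ[ a ]^[ n ] g
  Δ^-resp-≋ a zero    f≋g = f≋g
  Δ^-resp-≋ a (suc n) f≋g = Δ-resp-≋ a (Δ^-resp-≋ a n f≋g)

-- The central trinomial coefficients modulo a prime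

module _ {q : ℕ} (p-prime : Prime (suc q)) where

  private
    p : ℕ
    p = suc q

  open Congruence p

  1<p : 1 < p
  1<p = nonTrivial⇒n>1 p {{prime⇒nonTrivial p-prime}}

  p∣pCk : ∀ k → 0 < k → k < p → p ∣ p C k
  p∣pCk (suc k) _ k<p
    with euclidsLemma (suc k) (p C suc k) p-prime
           (divides (q C k) (trans ([k+1]*[n+1]C[k+1]≡[n+1]*nCk q k) (*-comm p (q C k))))
  ... | inj₁ p∣k+1 = contradiction (∣⇒≤ p∣k+1) (<⇒≱ k<p)
  ... | inj₂ p∣C     = p∣C

  pathSum-frobenius : ∀ g → pathSum p g ≈ g p 0 + g 0 p
  pathSum-frobenius g = begin
      pathSum p g
    ≡⟨ pathSum≡binomialSum p g ⟩
      G 0 + ∑ p (G ∘ suc)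
    ≡⟨ cong (λ s → G 0 + s) (∑-last q (G ∘ suc)) ⟩
      G 0 + (interior + G p)
    ≡⟨ ℕ+.x∙yz≈y∙xz (G 0) interior (G p) ⟩
      interior + (G 0 + G p)
    ≈⟨ multiple+≈ (G 0 + G p) p∣interior ⟩
      G 0 + G p
    ≡⟨ +-comm (G 0) (G p) ⟩
      G p + G 0
    ≡⟨ cong₂ _+_ (trans (cong₂ _*_ (nCn≡1 p) (cong (g p) (n∸n≡0 p))) (*-identityˡ (g p 0)))
                 (*-identityˡ (g 0 p)) ⟩
      g p 0 + g 0 p ∎
    where
    open ≈-Reasoning
    G : ℕ → ℕ
    G i = (p C i) * g i (p ∸ i)
    interior = ∑ q (G ∘ suc)
    p∣interior : p ∣ interior
    p∣interior = ∣-∑ q (G ∘ suc) (λ i i<q → ∣m⇒∣m*n _ (p∣pCk (suc i) z<s (s<s i<q)))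

  ∇-frobenius : ∀ f x → ∇^[ p ] f x ≈ f (x ℤ.- + p) + f x
  ∇-frobenius f x = begin
      ∇^[ p ] f x
    ≡⟨ ∇^-pathSum p f x ⟩
      pathSum p (λ i _ → f (x ℤ.- + i))
    ≈⟨ pathSum-frobenius (λ i _ → f (x ℤ.- + i)) ⟩
      f (x ℤ.- + p) + f (x ℤ.- + 0)
    ≡⟨ cong (λ y → f (x ℤ.- + p) + f y) (ℤP.+-identityʳ x) ⟩
      f (x ℤ.- + p) + f x ∎
    where open ≈-Reasoning

  Δ-frobenius : ∀ f → Δ[ 1 ]^[ p ] f ≋ Δ[ p ] f
  Δ-frobenius f j = begin
      Δ[ 1 ]^[ p ] f j
    ≡⟨ Δ^-pathSum p f j ⟩
      pathSum p (λ i m → ∇^[ m ] f (j ℤ.+ + i))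
    ≈⟨ pathSum-frobenius (λ i m → ∇^[ m ] f (j ℤ.+ + i)) ⟩
      f (j ℤ.+ + p) + ∇^[ p ] f (j ℤ.+ + 0)
    ≡⟨ cong (λ x → f (j ℤ.+ + p) + ∇^[ p ] f x) (ℤP.+-identityʳ j) ⟩
      f (j ℤ.+ + p) + ∇^[ p ] f j
    ≈⟨ +-congˡ (f (j ℤ.+ + p)) (∇-frobenius f j) ⟩
      f (j ℤ.+ + p) + (f (j ℤ.- + p) + f j)
    ≡⟨ ℕ+.x∙yz≈xz∙y (f (j ℤ.+ + p)) (f (j ℤ.- + p)) (f j) ⟩
      Δ[ p ] f j ∎
    where open ≈-Reasoning

  Δ^[n*p]≋Δ[p]^[n] : ∀ n f → Δ[ 1 ]^[ n * p ] f ≋ Δ[ p ]^[ n ] f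
  Δ^[n*p]≋Δ[p]^[n] zero    f j = ≈-refl
  Δ^[n*p]≋Δ[p]^[n] (suc n) f j = begin
      Δ[ 1 ]^[ p + n * p ] f j
    ≡⟨ cong-app (fold-+ f Δ[ 1 ] p) j ⟩
      Δ[ 1 ]^[ p ] (Δ[ 1 ]^[ n * p ] f) j
    ≈⟨ Δ-frobenius _ j ⟩
      Δ[ p ] (Δ[ 1 ]^[ n * p ] f) j
    ≈⟨ Δ-resp-≋ p (Δ^[n*p]≋Δ[p]^[n] n f) j ⟩
      Δ[ p ] (Δ[ p ]^[ n ] f) j ∎
    where open ≈-Reasoning

  lucas : ∀ n k → k < p → T (k + n * p) ≈ T n * T k
  lucas n k k<p = begin
      T (k + n * p)
    ≡⟨ coeff≗Δ^δ (k + n * p) (+ 0) ⟩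
      Δ[ 1 ]^[ k + n * p ] δ (+ 0)
    ≡⟨ cong-app (fold-+ δ Δ[ 1 ] k) (+ 0) ⟩
      Δ[ 1 ]^[ k ] (Δ[ 1 ]^[ n * p ] δ) (+ 0)
    ≈⟨ Δ^-resp-≋ 1 k (Δ^[n*p]≋Δ[p]^[n] n δ) (+ 0) ⟩
      Δ[ 1 ]^[ k ] (Δ[ p ]^[ n ] δ) (+ 0)
    ≡⟨ Δ^-local k (+ 0) nearZero ⟩
      Δ[ 1 ]^[ k ] (λ t → T n * δ t) (+ 0)
    ≡⟨ Δ^-*ˡ 1 k (T n) δ (+ 0) ⟩
      T n * Δ[ 1 ]^[ k ] δ (+ 0)
    ≡⟨ cong (T n *_) (coeff≗Δ^δ k (+ 0)) ⟨
      T n * T k ∎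
    where
    open ≈-Reasoning
    nearZero : ∀ u → ∣ u ∣ ≤ k → Δ[ p ]^[ n ] δ (+ 0 ℤ.+ u) ≡ T n * δ (+ 0 ℤ.+ u)
    nearZero u ∣u∣≤k rewrite ℤP.+-identityˡ u = Δ^δ-nearZero q n u (≤-trans ∣u∣≤k (<⇒≤pred k<p))

  lucas-digits : ∀ n → T n ≈ T (n / p) * T (n % p)
  lucas-digits n = begin
    T n                         ≡⟨ cong T (m≡m%n+[m/n]*n n p) ⟩
    T (n % p + n / p * p)       ≈⟨ lucas (n / p) (n % p) (m%n<n n p) ⟩
    T (n / p) * T (n % p)       ∎
    where open ≈-Reasoning

  lucas-block : ∀ K m r → r < p ^ K → T (r + m * p ^ K) ≈ T m * T r
  lucas-block zero    m zero    _ = ≈-reflexive (trans (cong T (*-identityʳ m)) (sym (*-identityʳ (T m))))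
  lucas-block zero    m (suc r) (s<s ())
  lucas-block (suc K) m r r<p^[K+1] = begin
      T (r + m * (p * p ^ K))
    ≡⟨ cong T regroup ⟩
      T (r % p + (r / p + m * p ^ K) * p)
    ≈⟨ lucas (r / p + m * p ^ K) (r % p) (m%n<n r p) ⟩
      T (r / p + m * p ^ K) * T (r % p)
    ≈⟨ *-congʳ (T (r % p)) (lucas-block K m (r / p) r/p<p^K) ⟩
      T m * T (r / p) * T (r % p)
    ≡⟨ *-assoc (T m) (T (r / p)) (T (r % p)) ⟩
      T m * (T (r / p) * T (r % p))
    ≈⟨ *-congˡ (T m) (lucas-digits r) ⟨
      T m * T r ∎
    where
    open ≈-Reasoning
    r/p<p^K : r / p < p ^ K
    r/p<p^K = m<n*o⇒m/o<n (subst (r <_) (*-comm p (p ^ K)) r<p^[K+1])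
    a+b*x+m*[x*y]≡a+[b+m*y]*x : ∀ a b m x y → a + b * x + m * (x * y) ≡ a + (b + m * y) * x
    a+b*x+m*[x*y]≡a+[b+m*y]*x = ℕ-Solver.solve-∀
    regroup : r + m * (p * p ^ K) ≡ r % p + (r / p + m * p ^ K) * p
    regroup = trans (cong (λ x → x + m * (p * p ^ K)) (m≡m%n+[m/n]*n r p))
                    (a+b*x+m*[x*y]≡a+[b+m*y]*x (r % p) (r / p) m p (p ^ K))

  p∤1 : ¬ p ∣ 1
  p∤1 p∣1 = <⇒≱ 1<p (∣⇒≤ p∣1)

  T-block-zero⁺ : ∀ K m r → r < p ^ K → (p ∣ T m) ⊎ (p ∣ T r) → p ∣ T (r + m * p ^ K)
  T-block-zero⁺ K m r r<p^K p∣Tm⊎p∣Tr =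
    ∣-resp-≈ (lucas-block K m r r<p^K) ([ ∣m⇒∣m*n (T r) , ∣n⇒∣m*n (T m) ]′ p∣Tm⊎p∣Tr)

  T-block-zero⁻ : ∀ K m r → r < p ^ K → p ∣ T (r + m * p ^ K) → (p ∣ T m) ⊎ (p ∣ T r)
  T-block-zero⁻ K m r r<p^K p∣T =
    euclidsLemma (T m) (T r) p-prime (∣-resp-≈ (≈-sym (lucas-block K m r r<p^K)) p∣T)

  zero-digit : ∀ n → p ∣ T n → ∃ λ d → d < p × p ∣ T d
  zero-digit = <-rec _ step
    where
    step : ∀ n → (∀ {m} → m < n → p ∣ T m → ∃ λ d → d < p × p ∣ T d) →
           p ∣ T n → ∃ λ d → d < p × p ∣ T d
    step zero      _   p∣T0 = contradiction p∣T0 p∤1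
    step n@(suc _) rec p∣Tn
      with euclidsLemma (T (n / p)) (T (n % p)) p-prime (∣-resp-≈ (≈-sym (lucas-digits n)) p∣Tn)
    ... | inj₁ p∣T[n/p] = rec (m/n<m n p 1<p) p∣T[n/p]
    ... | inj₂ p∣T[n%p] = n % p , m%n<n n p , p∣T[n%p]

  zero⇔zero-below-p : (∃ λ n → p ∣ T n) ⇔ (∃ λ n → n < p × p ∣ T n)
  zero⇔zero-below-p = mk⇔ (λ (n , p∣Tn) → zero-digit n p∣Tn) (λ (d , _ , p∣Td) → d , p∣Td)

  nonzero? : ℕ → Bool
  nonzero? = not ∘ isZeroMod p

  nonzero?-true⁻ : ∀ n → nonzero? n ≡ true → ¬ p ∣ T n
  nonzero?-true⁻ n nz p∣Tn with T n % p ≟ 0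
  ... | yes _       = contradiction nz λ ()
  ... | no Tn%p≢0   = Tn%p≢0 (n∣m⇒m%n≡0 (T n) p p∣Tn)

  nonzero?-true⁺ : ∀ n → ¬ p ∣ T n → nonzero? n ≡ true
  nonzero?-true⁺ n p∤Tn with T n % p ≟ 0
  ... | yes Tn%p≡0 = contradiction (m%n≡0⇒n∣m (T n) p Tn%p≡0) p∤Tn
  ... | no _       = refl

  nonzero?-false⁺ : ∀ n → p ∣ T n → nonzero? n ≡ false
  nonzero?-false⁺ n p∣Tn with T n % p ≟ 0
  ... | yes _     = refl
  ... | no Tn%p≢0 = contradiction (n∣m⇒m%n≡0 (T n) p p∣Tn) Tn%p≢0

  count-nonzero-blocks : ∀ K m →
                         count nonzero? (m * p ^ K) ≤ count nonzero? m * count nonzero? (p ^ K)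
  count-nonzero-blocks K = count-blocks nonzero? (p ^ K) λ m i i<p^K nz →
    let p∤T = nonzero?-true⁻ (i + m * p ^ K) nz in
    nonzero?-true⁺ m (λ p∣Tm → p∤T (T-block-zero⁺ K m i i<p^K (inj₁ p∣Tm))) ,
    nonzero?-true⁺ i (λ p∣Ti → p∤T (T-block-zero⁺ K m i i<p^K (inj₂ p∣Ti)))

  module _ {d} (d<p : d < p) (p∣Td : p ∣ T d) where

    count-nonzero-p^K : ∀ K → count nonzero? (p ^ K) ≤ q ^ K
    count-nonzero-p^K zero    = count-≤ nonzero? 1
    count-nonzero-p^K (suc K) = ≤-trans (count-nonzero-blocks K p)
      (*-mono-≤ (s≤s⁻¹ (count<N nonzero? p (nonzero?-false⁺ d p∣Td) d<p)) (count-nonzero-p^K K))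

    count-nonzero-sparse : ∀ K m → count nonzero? (m * p ^ K) ≤ m * q ^ K
    count-nonzero-sparse K m =
      ≤-trans (count-nonzero-blocks K m) (*-mono-≤ (count-≤ nonzero? m) (count-nonzero-p^K K))

  hasDensityOne-zeros : (∃ λ n → p ∣ T n) → HasDensityOne (isZeroMod p)
  hasDensityOne-zeros (n , p∣Tn) =
    let d , d<p , p∣Td = zero-digit n p∣Tn in
    hasDensityOne-if-sparse-complement (isZeroMod p) q {{>-nonZero (s≤s⁻¹ 1<p)}}
      (count-nonzero-sparse d<p p∣Td)

  *-cancelˡ-≈ : ∀ c {x y} → ¬ p ∣ c → c * x ≈ c * y → x ≈ y
  *-cancelˡ-≈ c {x} {y} p∤c cx≈cy =
    [ (λ x≤y → cancel x≤y cx≈cy) , (λ y≤x → ≈-sym (cancel y≤x (≈-sym cx≈cy))) ]′ (≤-total x y)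
    where
    cancel : ∀ {x y} → x ≤ y → c * x ≈ c * y → x ≈ y
    cancel {x} {y} x≤y cx≈cy =
      [ (λ p∣c → contradiction p∣c p∤c) , ∣∸⇒≈ x≤y ]′
        (euclidsLemma c (y ∸ x) p-prime (subst (p ∣_) (sym (*-distribˡ-∸ c y x)) (≈⇒∣∸ cx≈cy)))

  p∤^ : ∀ {v} → ¬ p ∣ v → ∀ e → ¬ p ∣ v ^ e
  p∤^ p∤v zero    = p∤1
  p∤^ p∤v (suc e) p∣v^[1+e] = [ p∤v , p∤^ p∤v e ]′ (euclidsLemma _ _ p-prime p∣v^[1+e])

  0≢x-mod-p : ∀ {x} → ¬ p ∣ x → Fin.zero ≢ x mod p
  0≢x-mod-p {x} p∤x 0≡x-mod-p =
    p∤x (m%n≡0⇒n∣m x p (trans (sym (toℕ-fromℕ< (m%n<n x p))) (sym (cong toℕ 0≡x-mod-p))))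

  unitResidue : ∀ x → ¬ p ∣ x → Fin q
  unitResidue x p∤x = punchOut (0≢x-mod-p p∤x)

  unitResidue-injective : ∀ {x y} p∤x p∤y → unitResidue x p∤x ≡ unitResidue y p∤y → x ≈ y
  unitResidue-injective {x} {y} p∤x p∤y same = mk≈ (begin
    x % p             ≡⟨ toℕ-fromℕ< (m%n<n x p) ⟨
    toℕ (x mod p)     ≡⟨ cong toℕ (punchOut-injective (0≢x-mod-p p∤x) (0≢x-mod-p p∤y) same) ⟩
    toℕ (y mod p)     ≡⟨ toℕ-fromℕ< (m%n<n y p) ⟩
    y % p             ∎)
    where open ≡-Reasoning

  units-pigeonhole : ∀ (v : ℕ → ℕ) → (∀ i → i ≤ q → ¬ p ∣ v i) →
                     ∃₂ λ a b → a < b × b ≤ q × v a ≈ v b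
  units-pigeonhole v p∤v =
    let a , b , a<b , same = pigeonhole (n<1+n q) λ i → unitResidue (v (toℕ i)) (p∤v _ (toℕ≤pred[n] i))
    in toℕ a , toℕ b , a<b , toℕ≤pred[n] b ,
       unitResidue-injective (p∤v _ (toℕ≤pred[n] a)) (p∤v _ (toℕ≤pred[n] b)) same

  unit-power≈1 : ∀ {v} → ¬ p ∣ v → ∃ λ e → v ^ suc e ≈ 1
  unit-power≈1 {v} p∤v with units-pigeonhole (v ^_) (λ i _ → p∤^ p∤v i)
  ... | a , b , a<b , _ , v^a≈v^b = e , ≈-sym (*-cancelˡ-≈ (v ^ a) (p∤^ p∤v a) (begin
      v ^ a * 1          ≡⟨ *-identityʳ (v ^ a) ⟩
      v ^ a              ≈⟨ v^a≈v^b ⟩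
      v ^ b              ≡⟨ cong (v ^_) b≡a+[1+e] ⟩
      v ^ (a + suc e)    ≡⟨ ^-distribˡ-+-* v a (suc e) ⟩
      v ^ a * v ^ suc e  ∎))
    where
    open ≈-Reasoning
    e = b ∸ suc a
    b≡a+[1+e] : b ≡ a + suc e
    b≡a+[1+e] = trans (sym (m+[n∸m]≡n a<b)) (sym (+-suc a e))

  -- The base-p expansion of n written e times in a row, each copy taking n digits.
  repeat : ℕ → ℕ → ℕ
  repeat n zero    = 0
  repeat n (suc e) = n + repeat n e * p ^ n

  T-repeat : ∀ n e → T (repeat n e) ≈ T n ^ e
  T-repeat n zero    = ≈-refl
  T-repeat n (suc e) = begin
    T (n + repeat n e * p ^ n)  ≈⟨ lucas-block n (repeat n e) n (n<m^n p 1<p n) ⟩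
    T (repeat n e) * T n        ≈⟨ *-congʳ (T n) (T-repeat n e) ⟩
    T n ^ e * T n               ≡⟨ *-comm (T n ^ e) (T n) ⟩
    T n ^ suc e                 ∎
    where open ≈-Reasoning

  T-inverse : ∀ n → ¬ p ∣ T n → ∃ λ m → T n * T m ≈ 1
  T-inverse n p∤Tn =
    let e , Tn^[1+e]≈1 = unit-power≈1 p∤Tn in
    repeat n e , ≈-trans (*-congˡ (T n) (T-repeat n e)) Tn^[1+e]≈1

  module _ {a b : ℕ} where

    private instance
      p^a≢0 : NonZero (p ^ a)
      p^a≢0 = m^n≢0 p a
      p^b≢0 : NonZero (p ^ b)
      p^b≢0 = m^n≢0 p b

    drop-digits< : ∀ n → a < b → p ^ b ≤ n → n % p ^ a + n / p ^ b * p ^ a < n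
    drop-digits< n a<b p^b≤n = begin-strict
        n % p ^ a + Q * p ^ a
      <⟨ +-monoˡ-< (Q * p ^ a) (m%n<n n (p ^ a)) ⟩
        suc Q * p ^ a
      ≤⟨ *-monoˡ-≤ (p ^ a) 1+Q≤Q*p ⟩
        Q * p * p ^ a
      ≡⟨ *-assoc Q p (p ^ a) ⟩
        Q * p ^ suc a
      ≤⟨ *-monoʳ-≤ Q (^-monoʳ-≤ p a<b) ⟩
        Q * p ^ b
      ≤⟨ m/n*n≤m n (p ^ b) ⟩
        n ∎
      where
      open ≤-Reasoning
      Q = n / p ^ b
      1+Q≤Q*p : suc Q ≤ Q * p
      1+Q≤Q*p = begin
        suc Q       ≤⟨ +-monoˡ-≤ Q (m≥n⇒m/n>0 p^b≤n) ⟩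
        Q + Q       ≤⟨ +-monoʳ-≤ Q (m≤m*n Q q {{>-nonZero (s≤s⁻¹ 1<p)}}) ⟩
        Q + Q * q   ≡⟨ *-suc Q q ⟨
        Q * p       ∎

    T-drop-digits : ∀ n → T (n % p ^ a) ≈ T (n % p ^ b) → T (n % p ^ a + n / p ^ b * p ^ a) ≈ T n
    T-drop-digits n same = begin
      T (n % p ^ a + n / p ^ b * p ^ a)  ≈⟨ lucas-block a (n / p ^ b) (n % p ^ a) (m%n<n n (p ^ a)) ⟩
      T (n / p ^ b) * T (n % p ^ a)      ≈⟨ *-congˡ (T (n / p ^ b)) same ⟩
      T (n / p ^ b) * T (n % p ^ b)      ≈⟨ lucas-block b (n / p ^ b) (n % p ^ b) (m%n<n n (p ^ b)) ⟨
      T (n % p ^ b + n / p ^ b * p ^ b)  ≡⟨ cong T (m≡m%n+[m/n]*n n (p ^ b)) ⟨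
      T n                                ∎
      where open ≈-Reasoning

  module _ (p∤T : ∀ n → ¬ p ∣ T n) where

    -- Among the p values T (n mod pᵃ), a ≤ q, two agree mod p; cutting out the digits
    -- between those two positions gives a smaller index with the same T value.
    T-representative : ∀ n → ∃ λ r → r < p ^ q × T r ≈ T n
    T-representative = <-rec _ step
      where
      step : ∀ n → (∀ {m} → m < n → ∃ λ r → r < p ^ q × T r ≈ T m) → ∃ λ r → r < p ^ q × T r ≈ T n
      step n rec with n <? p ^ q
      ... | yes n<p^q = n , n<p^q , ≈-refl
      ... | no n≮p^q =
        let a , b , a<b , b≤q , same = units-pigeonhole (T ∘ lastDigits) (λ a _ → p∤T (lastDigits a))
            r , r<p^q , Tr≈Tn′ = rec (drop-digits< n a<b (≤-trans (^-monoʳ-≤ p b≤q) (≮⇒≥ n≮p^q)))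
        in r , r<p^q , ≈-trans Tr≈Tn′ (T-drop-digits {a} {b} n same)
        where
        lastDigits : ℕ → ℕ
        lastDigits a = (n % p ^ a) {{m^n≢0 p a}}

    private instance
      p^q≢0 : NonZero (p ^ q)
      p^q≢0 = m^n≢0 p q

    ones-syndetic : ∀ Q → ∃ λ m → Q < m × m ≤ Q + 2 * p ^ q × T m ≈ 1
    ones-syndetic Q =
      let m₀ , TQ₁*Tm₀≈1 = T-inverse Q₁ (p∤T Q₁)
          r , r<P , Tr≈Tm₀ = T-representative m₀
      in r + Q₁ * P , Q<m r , m≤Q+2P r r<P ,
         ≈-trans (lucas-block q Q₁ r r<P) (≈-trans (*-congˡ (T Q₁) Tr≈Tm₀) TQ₁*Tm₀≈1)
      where
      P = p ^ q
      Q₁ = suc (Q / P)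
      Q<m : ∀ r → Q < r + Q₁ * P
      Q<m r = <-≤-trans (m<[1+m/n]*n Q P) (m≤n+m _ r)
      m≤Q+2P : ∀ r → r < P → r + Q₁ * P ≤ Q + 2 * P
      m≤Q+2P r r<P = begin
        r + Q₁ * P              ≤⟨ +-monoˡ-≤ (Q₁ * P) (<⇒≤ r<P) ⟩
        P + (P + Q / P * P)     ≡⟨ reassoc P (Q / P * P) ⟩
        Q / P * P + 2 * P       ≤⟨ +-monoˡ-≤ (2 * P) (m/n*n≤m Q P) ⟩
        Q + 2 * P               ∎
        where
        open ≤-Reasoning
        reassoc : ∀ x y → x + (x + y) ≡ y + 2 * x
        reassoc = ℕ-Solver.solve-∀

    uniformlyRecurrent : UniformlyRecurrent (λ n → T n % p)
    uniformlyRecurrent = uniformlyRecurrent-if-syndetic-copies (λ n → T n % p) (p ^_) (n<m^n p 1<p)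
      λ M → 2 * p ^ q , λ Q →
        let m , Q<m , m≤Q+D , Tm≈1 = ones-syndetic Q in
        m , Q<m , m≤Q+D , λ i i<p^M → ≈⇒%≡ (begin
          T (i + m * p ^ M)  ≈⟨ lucas-block M m i i<p^M ⟩
          T m * T i          ≈⟨ *-congʳ (T i) Tm≈1 ⟩
          1 * T i            ≡⟨ *-identityˡ (T i) ⟩
          T i                ∎)
      where open ≈-Reasoning

  repdigit : ℕ → ℕ → ℕ
  repdigit g zero    = 0
  repdigit g (suc L) = g + repdigit g L * p

  module _ {g} (g<p : g < p) where

    repdigit<p^L : ∀ L → repdigit g L < p ^ L
    repdigit<p^L zero    = z<s
    repdigit<p^L (suc L) = begin-strict
      g + repdigit g L * p   <⟨ +-monoˡ-< (repdigit g L * p) g<p ⟩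
      suc (repdigit g L) * p ≤⟨ *-monoˡ-≤ p (repdigit<p^L L) ⟩
      p ^ L * p              ≡⟨ *-comm (p ^ L) p ⟩
      p ^ suc L              ∎
      where open ≤-Reasoning

    T-repdigit-nonzero : ¬ p ∣ T g → ∀ L → ¬ p ∣ T (repdigit g L)
    T-repdigit-nonzero p∤Tg zero    = p∤1
    T-repdigit-nonzero p∤Tg (suc L) p∣T = [ T-repdigit-nonzero p∤Tg L , p∤Tg ]′
      (euclidsLemma _ _ p-prime (∣-resp-≈ (≈-sym (lucas (repdigit g L) g g<p)) p∣T))

    -- Comparing base-p digits from the top, the first digit where u exceeds g g … g
    -- is a zero digit.
    T-above-repdigit : (∀ e → g < e → e < p → p ∣ T e) →
                       ∀ L u → repdigit g L < u → u < p ^ L → p ∣ T u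
    T-above-repdigit zeros zero    u 0<u u<1 = contradiction 0<u (<⇒≱ u<1)
    T-above-repdigit zeros (suc L) u R<u u<p^[L+1] with u / p ≤? repdigit g L
    ... | yes u/p≤R = ∣-resp-≈ (lucas-digits u) (∣n⇒∣m*n (T (u / p)) (zeros (u % p) g<u%p (m%n<n u p)))
      where
      open ≤-Reasoning
      g<u%p : g < u % p
      g<u%p = +-cancelʳ-< (u / p * p) g (u % p) (begin-strict
        g + u / p * p          ≤⟨ +-monoʳ-≤ g (*-monoˡ-≤ p u/p≤R) ⟩
        g + repdigit g L * p   <⟨ R<u ⟩
        u                      ≡⟨ m≡m%n+[m/n]*n u p ⟩
        u % p + u / p * p      ∎)
    ... | no u/p≰R = ∣-resp-≈ (lucas-digits u) (∣m⇒∣m*n (T (u % p))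
      (T-above-repdigit zeros L (u / p) (≰⇒> u/p≰R) (m<n*o⇒m/o<n (subst (u <_) (*-comm p (p ^ L)) u<p^[L+1]))))

    zeros-after-repdigit : (∀ e → g < e → e < p → p ∣ T e) → ∀ L H → p ∣ T (suc H) →
                           ∀ t → 0 < t → t < p ^ L → p ∣ T (repdigit g L + H * p ^ L + t)
    zeros-after-repdigit zeros L H p∣T[1+H] t 0<t t<p^L with repdigit g L + t <? p ^ L
    ... | yes R+t<p^L =
      subst (λ x → p ∣ T x) (sym (ℕ+.xy∙z≈xz∙y (repdigit g L) (H * p ^ L) t))
        (T-block-zero⁺ L H (repdigit g L + t) R+t<p^L
          (inj₂ (T-above-repdigit zeros L (repdigit g L + t) (m<m+n _ 0<t) R+t<p^L)))
    ... | no R+t≮p^L =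
      subst (λ x → p ∣ T x) (sym position) (T-block-zero⁺ L (suc H) u′ u′<p^L (inj₁ p∣T[1+H]))
      where
      open ≡-Reasoning
      R = repdigit g L
      B = p ^ L
      B≤R+t : B ≤ R + t
      B≤R+t = ≮⇒≥ R+t≮p^L
      u′ = R + t ∸ B
      position : R + H * B + t ≡ u′ + suc H * B
      position = begin
        R + H * B + t      ≡⟨ ℕ+.xy∙z≈xz∙y R (H * B) t ⟩
        R + t + H * B      ≡⟨ cong (_+ H * B) (m∸n+n≡m B≤R+t) ⟨
        u′ + B + H * B     ≡⟨ +-assoc u′ B (H * B) ⟩
        u′ + suc H * B     ∎
      u′<p^L : u′ < B
      u′<p^L = +-cancelʳ-< B u′ B
        (subst (_< B + B) (sym (m∸n+n≡m B≤R+t)) (+-mono-< (repdigit<p^L L) t<p^L))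

    -- j has w trailing digits g and leading part a + X p, where T X inverts T a · T (g … g);
    -- so T j ≡ 1, and each j′ shortly after j either exceeds g … g in its last w digits
    -- or carries into the leading part a + 1 + X p, which contains the zero digit a + 1.
    one-followed-by-zeros : (∀ e → g < e → e < p → p ∣ T e) → ¬ p ∣ T g →
                            ∀ {a} → suc a < p → ¬ p ∣ T a → p ∣ T (suc a) →
                            ∀ w → ∃ λ j → T j ≈ 1 × (∀ j′ → j < j′ → j′ ≤ j + w → p ∣ T j′)
    one-followed-by-zeros zeros p∤Tg {a} a+1<p p∤Ta p∣T[a+1] w =
      let X , Tn₀*TX≈1 = T-inverse n₀ p∤Tn₀ in j X , Tj≈1 X Tn₀*TX≈1 , zeros-after X
      where
      R = repdigit g w
      B = p ^ w
      n₀ = R + a * B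
      j : ℕ → ℕ
      j X = R + (a + X * p) * B
      p∤Tn₀ : ¬ p ∣ T n₀
      p∤Tn₀ p∣Tn₀ = [ p∤Ta , T-repdigit-nonzero p∤Tg w ]′ (T-block-zero⁻ w a R (repdigit<p^L w) p∣Tn₀)
      Tj≈1 : ∀ X → T n₀ * T X ≈ 1 → T (j X) ≈ 1
      Tj≈1 X Tn₀*TX≈1 = begin
        T (R + (a + X * p) * B)   ≈⟨ lucas-block w (a + X * p) R (repdigit<p^L w) ⟩
        T (a + X * p) * T R       ≈⟨ *-congʳ (T R) (lucas X a (<-trans (n<1+n a) a+1<p)) ⟩
        T X * T a * T R           ≡⟨ *-assoc (T X) (T a) (T R) ⟩
        T X * (T a * T R)         ≈⟨ *-congˡ (T X) (lucas-block w a R (repdigit<p^L w)) ⟨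
        T X * T n₀                ≡⟨ *-comm (T X) (T n₀) ⟩
        T n₀ * T X                ≈⟨ Tn₀*TX≈1 ⟩
        1                         ∎
        where open ≈-Reasoning
      zeros-after : ∀ X j′ → j X < j′ → j′ ≤ j X + w → p ∣ T j′
      zeros-after X j′ j<j′ j′≤j+w =
        subst (λ x → p ∣ T x) (m+[n∸m]≡n (<⇒≤ j<j′))
          (zeros-after-repdigit zeros w (a + X * p)
            (∣-resp-≈ (lucas X (suc a) a+1<p) (∣n⇒∣m*n (T X) p∣T[a+1]))
            (j′ ∸ j X) (m<n⇒0<n∸m j<j′) (≤-<-trans (m≤n+o⇒m∸n≤o j′ (j X) j′≤j+w) (n<m^n p 1<p w)))

  ¬uniformlyRecurrent : (∃ λ n → p ∣ T n) → ¬ UniformlyRecurrent (λ n → T n % p)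
  ¬uniformlyRecurrent (n , p∣Tn) = ¬uniformlyRecurrent-if-long-gaps (λ n → T n % p) λ w →
    let d , d<p , p∣Td = zero-digit n p∣Tn
        a , a+1≤d , p∤Ta , p∣T[a+1] = zero-after-nonzero (λ m → p ∣? T m) p∤1 p∣Td
        g , g≤q , p∤Tg , zeros-above = last-nonzero (λ m → p ∣? T m) p∤1 q
        j , Tj≈1 , zeros-after = one-followed-by-zeros (s≤s g≤q)
          (λ e g<e e<p → zeros-above e g<e (s≤s⁻¹ e<p)) p∤Tg (≤-<-trans a+1≤d d<p) p∤Ta p∣T[a+1] w
    in j , ≈⇒%≡ Tj≈1 , λ j′ j<j′ j′≤j+w Tj′≡T0 →
       p∤1 (∣-resp-≈ (mk≈ (sym Tj′≡T0)) (zeros-after j′ j<j′ j′≤j+w))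

  uniformlyRecurrent⇔noZero : UniformlyRecurrent (λ n → T n % p) ⇔ (¬ ∃ λ n → p ∣ T n)
  uniformlyRecurrent⇔noZero = mk⇔ (λ recurrent zero → ¬uniformlyRecurrent zero recurrent)
                                  (λ noZero → uniformlyRecurrent (λ n p∣Tn → noZero (n , p∣Tn)))

corollary3p9 : (p : ℕ) → .{{_ : NonZero p}} → Prime p →
    (UniformlyRecurrent (λ n → T n % p) ⇔ (¬ ∃ λ n → p ∣ T n))
    × ((∃ λ n → p ∣ T n) ⇔ (∃ λ n → n < p × p ∣ T n))
    × ((∃ λ n → p ∣ T n) → HasDensityOne (isZeroMod p))
corollary3p9 (suc q) p-prime =
  uniformlyRecurrent⇔noZero p-prime , zero⇔zero-below-p p-prime , hasDensityOne-zeros p-prime
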